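{- Let $G$ be a connected graph and let $A, B$ be two linked, disjoint and saturated subsets of $V(G)$ such that $N(A\cup B)$ is not a clique. Then for every clique $K\subseteq N(A\cup B)$, both $A\cup K$ and $B\cup K$ are convex.
   Context: All graphs are finite, undirected and loopless. For $X\subseteq V(G)$, $N(X)=\{u\in V(G)\setminus X : u\text{ adjacent to some }x\in X\}$. A chordless $uv$-path is a $uv$-path that is an induced subgraph. A set $C$ is convex (monophonically convex) if for all $u,v\in C$ every vertex on a chordless $uv$-path lies in $C$; $\mathrm{cl}(X)$ is the intersection of all convex sets containing $X$. $A,B$ are linked if some vertex of $A$ is adjacent to some vertex of $B$. $A/B=\{v : \mathrm{cl}(B\cup\{v\})\cap A\ne\emptyset\}$. A set $X\subseteq V(G)\setminus(A\cup B)$ is forbidden if $\mathrm{cl}(X)$ meets both $A$ and $B$; $\mathrm{mfs}(A,B)$ is the family of inclusion-minimal forbidden sets. $\sigma(A,B)=\mathrm{cl}\big(A/B\cup\bigcup\{\bigcap_{x\in X}\mathrm{cl}(A\cup\{x\}) : X\in\mathrm{mfs}(A,B)\}\big)$; $S(A,B)=\bigcup_{i\ge0}\sigma(A_i,B_i)$ with $A_0=A$, $B_0=B$, $A_i=\sigma(A_{i-1},B_{i-1})$, $B_i=\sigma(B_{i-1},A_{i-1})$; $A,B$ are saturated if $A=S(A,B)$ and $B=S(B,A)$. -}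

module Defs where

open import Data.Nat using (ℕ; zero; suc)
open import Data.Fin using (Fin; toℕ; fromℕ) renaming (zero to fz)
open import Data.Fin.Subset using (Subset; _∈_; _⊆_; ⁅_⁆)
open import Data.Bool using (Bool; true; false)
open import Data.Product using (Σ; ∃; ∃-syntax; _×_; _,_)
open import Data.Sum using (_⊎_; inj₁; inj₂)
open import Data.Empty using (⊥)
open import Relation.Nullary using (¬_)
open import Relation.Binary.PropositionalEquality using (_≡_; _≢_)
open import Level using (0ℓ)
open import Relation.Unary using (Pred) renaming (_⊆_ to _⊆ₚ_; _∪_ to _∪ₚ_; _∩_ to _∩ₚ_)

record Graph (n : ℕ) : Set where
  field
    E     : Fin n → Fin n → Bool
    sym   : ∀ u v → E u v ≡ E v u
    loopless : ∀ v → E v v ≡ false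

VSet : ℕ → Set₁
VSet n = Pred (Fin n) 0ℓ

_≐_ : ∀ {n} → VSet n → VSet n → Set
A ≐ B = (A ⊆ₚ B) × (B ⊆ₚ A)

⟦_⟧ : ∀ {n} → Subset n → VSet n
⟦ X ⟧ v = v ∈ X

｛_｝ : ∀ {n} → Fin n → VSet n
｛ x ｝ v = v ≡ x

module _ {n : ℕ} (G : Graph n) where
  open Graph G

  Adj : Fin n → Fin n → Set
  Adj u v = E u v ≡ true

  Connected : Set
  Connected = ∀ u v → ∃[ k ] Σ (Fin (suc k) → Fin n) λ p →
      (p fz ≡ u) × (p (fromℕ k) ≡ v)
    × (∀ i j → toℕ j ≡ suc (toℕ i) → Adj (p i) (p j))

  Consec : ∀ {m} → Fin m → Fin m → Set
  Consec i j = (toℕ j ≡ suc (toℕ i)) ⊎ (toℕ i ≡ suc (toℕ j))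

  ChordlessPath : Fin n → Fin n → (k : ℕ) → (Fin (suc k) → Fin n) → Set
  ChordlessPath u v k p =
      (p fz ≡ u) × (p (fromℕ k) ≡ v)
    × (∀ i j → p i ≡ p j → i ≡ j)
    × (∀ i j → Consec i j → Adj (p i) (p j))
    × (∀ i j → Adj (p i) (p j) → Consec i j)

  Convex : VSet n → Set
  Convex C = ∀ u v → C u → C v → ∀ k p → ChordlessPath u v k p → ∀ i → C (p i)

  cl : VSet n → VSet n
  cl X v = ∀ (C : Subset n) → Convex ⟦ C ⟧ → X ⊆ₚ ⟦ C ⟧ → v ∈ C

  Linked : VSet n → VSet n → Set
  Linked A B = ∃[ a ] ∃[ b ] A a × B b × Adj a b

  Disjoint : VSet n → VSet n → Set
  Disjoint A B = ∀ v → A v → B v → ⊥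

  N : VSet n → VSet n
  N X u = ¬ X u × ∃[ x ] X x × Adj u x

  Clique : VSet n → Set
  Clique K = ∀ u v → K u → K v → u ≢ v → Adj u v

  _/_ : VSet n → VSet n → VSet n
  (A / B) v = ∃[ a ] A a × cl (B ∪ₚ ｛ v ｝) a

  Forbidden : VSet n → VSet n → Subset n → Set
  Forbidden A B X =
      (∀ x → x ∈ X → ¬ A x × ¬ B x)
    × (∃[ a ] cl ⟦ X ⟧ a × A a)
    × (∃[ b ] cl ⟦ X ⟧ b × B b)

  MFS : VSet n → VSet n → Subset n → Set
  MFS A B X = Forbidden A B X × (∀ Y → Y ⊆ X → Forbidden A B Y → X ⊆ Y)

  MidPart : VSet n → VSet n → VSet n
  MidPart A B v = ∃[ X ] MFS A B X × (∀ x → x ∈ X → cl (A ∪ₚ ｛ x ｝) v)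

  σ : VSet n → VSet n → VSet n
  σ A B = cl ((A / B) ∪ₚ MidPart A B)

  iter : VSet n → VSet n → ℕ → VSet n × VSet n
  iter A B zero = A , B
  iter A B (suc i) with iter A B i
  ... | Ai , Bi = σ Ai Bi , σ Bi Ai

  S : VSet n → VSet n → VSet n
  S A B v = ∃[ i ] (let (Ai , Bi) = iter A B i in σ Ai Bi v)

  Saturated : VSet n → VSet n → Set
  Saturated A B = (A ≐ S A B) × (B ≐ S B A)

{-# OPTIONS --safe #-}
-- Saturation makes A and B convex, ¬¬-stable (they are closures over a finite vertex set),
-- and closed under A/B and under the middle parts of minimal forbidden sets.  Using the link
-- between A and B and chordless paths through the convex side, every vertex of N(A ∪ B) has
-- neighbours in both A and B, and a nonadjacent pair {p, r} in N(A ∪ B) is a minimal forbidden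
-- set.  When N(A ∪ B) is not a clique this forces all of N(A ∪ B) to have the same neighbours
-- in A.  Then a chordless path from u ∈ N(A ∪ B) to A lies in A after u: were its last vertex
-- outside A in N(A ∪ B), its successor in A would be a neighbour of u, i.e. a chord.  So A ∪ {u}
-- is convex, and A ∪ K is convex because distinct vertices of the clique K are joined only by
-- an edge.
module Submission where

open import Defs
open import Data.Bool using (true)
import Data.Bool.Properties as Bool
open import Data.Empty using (⊥; ⊥-elim)
open import Data.Fin using (Fin; toℕ; fromℕ) renaming (zero to fz; suc to fs)
open import Data.Fin.Properties using (toℕ-injective; toℕ-fromℕ; toℕ≤pred[n]) renaming (_≟_ to _≟ᶠ_)
open import Data.Fin.Subset using (Subset; _∈_; _∉_; ⁅_⁆) renaming (_∪_ to _∪ˢ_; _⊆_ to _⊆ˢ_)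
open import Data.Fin.Subset.Properties using (_∈?_; x∈⁅x⁆; x∈⁅y⁆⇒x≡y; x∈p∪q⁺; x∈p∪q⁻)
open import Data.Nat using (ℕ; zero; suc; _+_; _∸_; _≤_; _<_; z≤n; s≤s)
open import Data.Nat.Properties
open import Data.Product using (_×_; _,_; ∃-syntax)
open import Data.Sum as Sum using (_⊎_; inj₁; inj₂; [_,_]′)
open import Data.Unit using (tt)
open import Effect.Monad using (RawMonad)
open import Function using (_∘_; id)
open import Level using (0ℓ)
open import Relation.Binary.PropositionalEquality
open import Relation.Nullary using (¬_; Dec; yes; no)
open import Relation.Nullary.Decidable using (decidable-stable; _⊎-dec_)
open import Relation.Nullary.Negation using (¬¬-Monad; ¬¬-map)
open import Relation.Unary using (U) renaming (_⊆_ to _⊆ₚ_; _∪_ to _∪ₚ_)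

module Adjacency {n : ℕ} (G : Graph n) where

  adj? : ∀ u v → Dec (Adj G u v)
  adj? u v = Graph.E G u v Bool.≟ true

  Adj-sym : ∀ {u v} → Adj G u v → Adj G v u
  Adj-sym {u} {v} = trans (Graph.sym G v u)

  Adj-irrefl : ∀ {u} → ¬ Adj G u u
  Adj-irrefl {u} uu with trans (sym uu) (Graph.loopless G u)
  ... | ()

  Adj⇒≢ : ∀ {u v} → Adj G u v → u ≢ v
  Adj⇒≢ uv refl = Adj-irrefl uv

  Linked-sym : ∀ {A B} → Linked G A B → Linked G B A
  Linked-sym (a , b , ha , hb , ab) = b , a , hb , ha , Adj-sym ab

  N-∪-comm : ∀ {A B} → N G (A ∪ₚ B) ⊆ₚ N G (B ∪ₚ A)
  N-∪-comm (∉A∪B , y , y∈A∪B , xy) = ∉A∪B ∘ Sum.swap , y , Sum.swap y∈A∪B , xy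

  Clique-⊆ : ∀ {Y Z} → Y ⊆ₚ Z → Clique G Z → Clique G Y
  Clique-⊆ Y⊆Z clique u v yu yv = clique u v (Y⊆Z yu) (Y⊆Z yv)

  ¬Clique⇒nonadjacent-pair : ∀ {Y} → ¬ Clique G Y →
    ¬ ¬ (∃[ x ] ∃[ y ] Y x × Y y × x ≢ y × ¬ Adj G x y)
  ¬Clique⇒nonadjacent-pair ¬clique no-pair = ¬clique λ x y yx yy x≢y →
    decidable-stable (adj? x y) λ ¬xy → no-pair (x , y , yx , yy , x≢y , ¬xy)

clamp : (k : ℕ) → ℕ → Fin (suc k)
clamp zero    _       = fz
clamp (suc k) zero    = fz
clamp (suc k) (suc m) = fs (clamp k m)

toℕ-clamp : ∀ {k m} → m ≤ k → toℕ (clamp k m) ≡ m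
toℕ-clamp {zero}  z≤n     = refl
toℕ-clamp {suc k} z≤n     = refl
toℕ-clamp {suc k} (s≤s m≤k) = cong suc (toℕ-clamp m≤k)

clamp-toℕ : ∀ {k} (i : Fin (suc k)) → clamp k (toℕ i) ≡ i
clamp-toℕ {zero}  fz     = refl
clamp-toℕ {suc k} fz     = refl
clamp-toℕ {suc k} (fs i) = cong fs (clamp-toℕ i)

clamp-zero : ∀ k → clamp k 0 ≡ fz
clamp-zero zero    = refl
clamp-zero (suc k) = refl

clamp-self : ∀ k → clamp k k ≡ fromℕ k
clamp-self zero    = refl
clamp-self (suc k) = cong fs (clamp-self k)

clamp-consecutive : ∀ {k i} → i < k → toℕ (clamp k (suc i)) ≡ suc (toℕ (clamp k i))
clamp-consecutive i<k = trans (toℕ-clamp i<k) (cong suc (sym (toℕ-clamp (≤-trans (n≤1+n _) i<k))))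

last-satisfying : (P : ℕ → Set) → (∀ i → Dec (P i)) → (L : ℕ) → P 0 →
  ∃[ m ] m ≤ L × P m × (∀ j → m < j → j ≤ L → ¬ P j)
last-satisfying P P? zero p₀ = 0 , z≤n , p₀ , λ j 0<j j≤0 _ → <-irrefl refl (≤-trans 0<j j≤0)
last-satisfying P P? (suc L) p₀ with P? (suc L)
... | yes pL = suc L , ≤-refl , pL , λ j L<j j≤L _ → <-irrefl refl (≤-trans L<j j≤L)
... | no ¬pL with last-satisfying P P? L p₀
...   | m , m≤L , pm , none-after = m , m≤n⇒m≤1+n m≤L , pm , none-after′
  where
  none-after′ : ∀ j → m < j → j ≤ suc L → ¬ P j
  none-after′ j m<j j≤1+L with m≤n⇒m<n∨m≡n j≤1+L
  ... | inj₁ (s≤s j≤L) = none-after j m<j j≤L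
  ... | inj₂ refl      = ¬pL

module Paths {n : ℕ} (G : Graph n) where
  open Adjacency G

  infixr 5 _∷⟨_⟩_ _++_

  data Walk (H : VSet n) : Fin n → Fin n → Set where
    [_]    : ∀ {s} → H s → Walk H s s
    _∷⟨_⟩_ : ∀ {s s₁ t} → H s → Adj G s s₁ → Walk H s₁ t → Walk H s t

  _++_ : ∀ {H s t r} → Walk H s t → Walk H t r → Walk H s r
  [ _ ]        ++ w′ = w′
  (h ∷⟨ e ⟩ w) ++ w′ = h ∷⟨ e ⟩ (w ++ w′)

  weaken : ∀ {H H′ s t} → H ⊆ₚ H′ → Walk H s t → Walk H′ s t
  weaken H⊆H′ [ h ]        = [ H⊆H′ h ]
  weaken H⊆H′ (h ∷⟨ e ⟩ w) = H⊆H′ h ∷⟨ e ⟩ weaken H⊆H′ w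

  walk-along : ∀ {H} (f : ℕ → Fin n) k → (∀ i → i < k → Adj G (f i) (f (suc i))) →
    (∀ i → i ≤ k → H (f i)) → Walk H (f 0) (f k)
  walk-along f zero    _    inH = [ inH 0 z≤n ]
  walk-along f (suc k) step inH = inH 0 z≤n ∷⟨ step 0 (s≤s z≤n) ⟩
    walk-along (f ∘ suc) k (λ i i<k → step (suc i) (s≤s i<k)) (λ i i≤k → inH (suc i) (s≤s i≤k))

  -- An ℕ-indexed ChordlessPath with all vertices in H; vertex i is junk for i > len.
  record Path (H : VSet n) (s t : Fin n) : Set where
    field
      len       : ℕ
      vertex    : ℕ → Fin n
      start     : vertex 0 ≡ s
      end       : vertex len ≡ t
      inside    : ∀ i → i ≤ len → H (vertex i)
      step      : ∀ i → i < len → Adj G (vertex i) (vertex (suc i))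
      injective : ∀ i j → i ≤ len → j ≤ len → vertex i ≡ vertex j → i ≡ j
      chordless : ∀ i j → i ≤ len → j ≤ len → Adj G (vertex i) (vertex j) → j ≡ suc i ⊎ i ≡ suc j

  open Path

  Path⇒Walk : ∀ {H H′ s t} (P : Path H s t) → (∀ i → i ≤ len P → H′ (vertex P i)) → Walk H′ s t
  Path⇒Walk {H′ = H′} P inH′ = subst₂ (Walk H′) (start P) (end P) (walk-along (vertex P) (len P) (step P) inH′)

  trivial : ∀ {H s} → H s → Path H s s
  trivial {s = s} hs = record
    { len = 0 ; vertex = λ _ → s ; start = refl ; end = refl ; inside = λ _ _ → hs
    ; step = λ _ () ; injective = λ { 0 0 _ _ _ → refl } ; chordless = λ _ _ _ _ ss → ⊥-elim (Adj-irrefl ss) }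

  drop : ∀ {H s t} (P : Path H s t) m → m ≤ len P → Path H (vertex P m) t
  drop P m m≤len = record
    { len       = len P ∸ m
    ; vertex    = λ i → vertex P (i + m)
    ; start     = refl
    ; end       = trans (cong (vertex P) (m∸n+n≡m m≤len)) (end P)
    ; inside    = λ i i≤ → inside P (i + m) (shift i≤)
    ; step      = λ i i< → step P (i + m) (shift i<)
    ; injective = λ i j i≤ j≤ e → +-cancelʳ-≡ m i j (injective P (i + m) (j + m) (shift i≤) (shift j≤) e)
    ; chordless = λ i j i≤ j≤ a →
        Sum.map (+-cancelʳ-≡ m j (suc i)) (+-cancelʳ-≡ m i (suc j)) (chordless P (i + m) (j + m) (shift i≤) (shift j≤) a)
    }
    where
    shift : ∀ {i} → i ≤ len P ∸ m → i + m ≤ len P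
    shift i≤ = subst (_ ≤_) (m∸n+n≡m m≤len) (+-monoˡ-≤ m i≤)

  prepend : ∀ {H s x t} (P : Path H x t) → H s → Adj G s x →
    (∀ i → i ≤ len P → vertex P i ≢ s) → (∀ i → suc i ≤ len P → ¬ Adj G s (vertex P (suc i))) → Path H s t
  prepend {H} {s} P hs sx ≢s ¬adj = record
    { len = suc (len P) ; vertex = vertex′ ; start = refl ; end = end P
    ; inside = inside′ ; step = step′ ; injective = injective′ ; chordless = chordless′ }
    where
    vertex′ : ℕ → Fin n
    vertex′ zero    = s
    vertex′ (suc i) = vertex P i
    inside′ : ∀ i → i ≤ suc (len P) → H (vertex′ i)
    inside′ zero    _         = hs
    inside′ (suc i) (s≤s i≤) = inside P i i≤
    step′ : ∀ i → i < suc (len P) → Adj G (vertex′ i) (vertex′ (suc i))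
    step′ zero    _         = subst (Adj G s) (sym (start P)) sx
    step′ (suc i) (s≤s i<) = step P i i<
    injective′ : ∀ i j → i ≤ suc (len P) → j ≤ suc (len P) → vertex′ i ≡ vertex′ j → i ≡ j
    injective′ zero    zero    _         _         _ = refl
    injective′ zero    (suc j) _         (s≤s j≤) e = ⊥-elim (≢s j j≤ (sym e))
    injective′ (suc i) zero    (s≤s i≤) _         e = ⊥-elim (≢s i i≤ e)
    injective′ (suc i) (suc j) (s≤s i≤) (s≤s j≤) e = cong suc (injective P i j i≤ j≤ e)
    chordless′ : ∀ i j → i ≤ suc (len P) → j ≤ suc (len P) → Adj G (vertex′ i) (vertex′ j) → j ≡ suc i ⊎ i ≡ suc j
    chordless′ zero          zero          _         _         a = ⊥-elim (Adj-irrefl a)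
    chordless′ zero          (suc zero)    _         _         _ = inj₁ refl
    chordless′ zero          (suc (suc j)) _         (s≤s j≤) a = ⊥-elim (¬adj j j≤ a)
    chordless′ (suc zero)    zero          _         _         _ = inj₂ refl
    chordless′ (suc (suc i)) zero          (s≤s i≤) _         a = ⊥-elim (¬adj i i≤ (Adj-sym a))
    chordless′ (suc i)       (suc j)       (s≤s i≤) (s≤s j≤) a =
      Sum.map (cong suc) (cong suc) (chordless P i j i≤ j≤ a)

  reverse : ∀ {H s t} → Path H s t → Path H t s
  reverse P = record
    { len       = len P
    ; vertex    = λ i → vertex P (len P ∸ i)
    ; start     = end P
    ; end       = trans (cong (vertex P) (n∸n≡0 (len P))) (start P)
    ; inside    = λ i _ → inside P (len P ∸ i) (m∸n≤m (len P) i)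
    ; step      = step′
    ; injective = λ i j i≤ j≤ e → ∸-cancelˡ-≡ i≤ j≤ (injective P _ _ (m∸n≤m (len P) i) (m∸n≤m (len P) j) e)
    ; chordless = λ i j i≤ j≤ a →
        Sum.swap (Sum.map (mirror i≤ j≤) (mirror j≤ i≤) (chordless P _ _ (m∸n≤m (len P) i) (m∸n≤m (len P) j) a))
    }
    where
    mirror : ∀ {i j} → j ≤ len P → i ≤ len P → len P ∸ i ≡ suc (len P ∸ j) → j ≡ suc i
    mirror {i} {j} j≤ i≤ e = +-cancelˡ-≡ (len P ∸ j) j (suc i) (begin
      len P ∸ j + j           ≡⟨ m∸n+n≡m j≤ ⟩
      len P                   ≡⟨ sym (m∸n+n≡m i≤) ⟩
      len P ∸ i + i           ≡⟨ cong (_+ i) e ⟩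
      suc (len P ∸ j) + i     ≡⟨ sym (+-suc (len P ∸ j) i) ⟩
      len P ∸ j + suc i       ∎)
      where open ≡-Reasoning
    step′ : ∀ i → i < len P → Adj G (vertex P (len P ∸ i)) (vertex P (len P ∸ suc i))
    step′ i i< = Adj-sym (subst (λ j → Adj G (vertex P (len P ∸ suc i)) (vertex P j)) (sym e)
                                (step P (len P ∸ suc i) (subst (_≤ len P) e (m∸n≤m (len P) i))))
      where
      e : len P ∸ i ≡ suc (len P ∸ suc i)
      e = +-∸-assoc 1 i<

  -- Enter P at its last vertex equal or adjacent to s, so that s gets no chord.
  shortcut : ∀ {H s s₁ t} → Path H s₁ t → H s → Adj G s s₁ → Path H s t
  shortcut {H} {s} {t = t} P hs ss₁ with last-satisfying touches touches? (len P) (inj₂ (subst (Adj G s) (sym (start P)) ss₁))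
    where
    touches : ℕ → Set
    touches i = vertex P i ≡ s ⊎ Adj G s (vertex P i)
    touches? : ∀ i → Dec (touches i)
    touches? i = (vertex P i ≟ᶠ s) ⊎-dec adj? s (vertex P i)
  ... | m , m≤len , inj₁ vm≡s , _ = subst (λ x → Path H x t) vm≡s (drop P m m≤len)
  ... | m , m≤len , inj₂ s-vm , untouched = prepend (drop P m m≤len) hs s-vm ≢s ¬adj
    where
    later : ∀ {i} → suc i ≤ len P ∸ m → suc i + m ≤ len P
    later i< = subst (_ ≤_) (m∸n+n≡m m≤len) (+-monoˡ-≤ m i<)
    ≢s : ∀ i → i ≤ len P ∸ m → vertex P (i + m) ≢ s
    ≢s zero    _  = Adj⇒≢ s-vm ∘ sym
    ≢s (suc i) i< = untouched (suc i + m) (s≤s (m≤n+m m i)) (later i<) ∘ inj₁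
    ¬adj : ∀ i → suc i ≤ len P ∸ m → ¬ Adj G s (vertex P (suc i + m))
    ¬adj i i< = untouched (suc i + m) (s≤s (m≤n+m m i)) (later i<) ∘ inj₂

  fromWalk : ∀ {H s t} → Walk H s t → Path H s t
  fromWalk [ h ]        = trivial h
  fromWalk (h ∷⟨ e ⟩ w) = shortcut (fromWalk w) h e

  fromChordlessPath : ∀ {u v k p} → ChordlessPath G u v k p → Path U u v
  fromChordlessPath {k = k} {p} (p₀ , pₖ , p-injective , p-step , p-chordless) = record
    { len       = k
    ; vertex    = p ∘ clamp k
    ; start     = trans (cong p (clamp-zero k)) p₀
    ; end       = trans (cong p (clamp-self k)) pₖ
    ; inside    = λ _ _ → tt
    ; step      = λ i i<k → p-step _ _ (inj₁ (clamp-consecutive i<k))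
    ; injective = λ i j i≤ j≤ e →
        trans (sym (toℕ-clamp i≤)) (trans (cong toℕ (p-injective _ _ e)) (toℕ-clamp j≤))
    ; chordless = λ i j i≤ j≤ a → Sum.map (unclamp j≤ i≤) (unclamp i≤ j≤) (p-chordless _ _ a)
    }
    where
    unclamp : ∀ {i j} → i ≤ k → j ≤ k → toℕ (clamp k i) ≡ suc (toℕ (clamp k j)) → i ≡ suc j
    unclamp i≤ j≤ e = trans (sym (toℕ-clamp i≤)) (trans e (cong suc (toℕ-clamp j≤)))

  toChordlessPath : ∀ {H s t} (P : Path H s t) → ChordlessPath G s t (len P) (vertex P ∘ toℕ)
  toChordlessPath P =
      start P
    , trans (cong (vertex P) (toℕ-fromℕ (len P))) (end P)
    , (λ i j e → toℕ-injective (injective P _ _ (toℕ≤pred[n] i) (toℕ≤pred[n] j) e))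
    , consecutive
    , (λ i j a → chordless P _ _ (toℕ≤pred[n] i) (toℕ≤pred[n] j) a)
    where
    forward : ∀ i j → toℕ j ≡ suc (toℕ i) → Adj G (vertex P (toℕ i)) (vertex P (toℕ j))
    forward i j e = subst (λ m → Adj G (vertex P (toℕ i)) (vertex P m)) (sym e)
                          (step P (toℕ i) (subst (_≤ len P) e (toℕ≤pred[n] j)))
    consecutive : ∀ i j → Consec G i j → Adj G (vertex P (toℕ i)) (vertex P (toℕ j))
    consecutive i j (inj₁ e) = forward i j e
    consecutive i j (inj₂ e) = Adj-sym (forward j i e)

  closed-path-constant : ∀ {u k p} → ChordlessPath G u u k p → ∀ i → p i ≡ u
  closed-path-constant {k = k} {p} (p₀ , pₖ , p-injective , _) i = trans (cong p i≡0) p₀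
    where
    k≡0 : k ≡ 0
    k≡0 = trans (sym (toℕ-fromℕ k)) (cong toℕ (sym (p-injective fz (fromℕ k) (trans p₀ (sym pₖ)))))
    i≡0 : i ≡ fz
    i≡0 = toℕ-injective (n≤0⇒n≡0 (subst (toℕ i ≤_) k≡0 (toℕ≤pred[n] i)))

  adjacent-ends : ∀ {s t k p} → ChordlessPath G s t k p → Adj G s t → ∀ i → p i ≡ s ⊎ p i ≡ t
  adjacent-ends {s} {t} {k} {p} (p₀ , pₖ , _ , _ , p-chordless) st
    with p-chordless fz (fromℕ k) (subst₂ (Adj G) (sym p₀) (sym pₖ) st)
  ... | inj₁ k≡1 = two-vertices (trans (sym (toℕ-fromℕ k)) k≡1) p₀ pₖ
    where
    two-vertices : ∀ {k} {p : Fin (suc k) → Fin n} → k ≡ 1 → p fz ≡ s → p (fromℕ k) ≡ t → ∀ i → p i ≡ s ⊎ p i ≡ t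
    two-vertices refl p₀ _  fz      = inj₁ p₀
    two-vertices refl _  p₁ (fs fz) = inj₂ p₁

module Closure {n : ℕ} (G : Graph n) where
  open Adjacency G
  open Paths G
  open Path

  ⊆-cl : ∀ {X} → X ⊆ₚ cl G X
  ⊆-cl x _ _ X⊆C = X⊆C x

  cl-convex : ∀ X → Convex G (cl G X)
  cl-convex X u v cu cv k p cp i C convC X⊆C = convC u v (cu C convC X⊆C) (cv C convC X⊆C) k p cp i

  cl-least : ∀ {X Y} → X ⊆ₚ cl G Y → cl G X ⊆ₚ cl G Y
  cl-least X⊆clY x C convC Y⊆C = x C convC (λ y → X⊆clY y C convC Y⊆C)

  cl-stable : ∀ {X v} → ¬ ¬ cl G X v → cl G X v
  cl-stable {v = v} ¬¬v C convC X⊆C = decidable-stable (v ∈? C) (¬¬-map (λ c → c C convC X⊆C) ¬¬v)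

  convex-⁅⁆ : ∀ r → Convex G ⟦ ⁅ r ⁆ ⟧
  convex-⁅⁆ r u v u∈ v∈ k p cp i with x∈⁅y⁆⇒x≡y r u∈ | x∈⁅y⁆⇒x≡y r v∈
  ... | refl | refl = subst (_∈ ⁅ r ⁆) (sym (closed-path-constant cp i)) (x∈⁅x⁆ r)

  cl-⊆-｛｝ : ∀ {Y r} → ⟦ Y ⟧ ⊆ₚ ｛ r ｝ → cl G ⟦ Y ⟧ ⊆ₚ ｛ r ｝
  cl-⊆-｛｝ {r = r} Y⊆r v∈cl =
    x∈⁅y⁆⇒x≡y r (v∈cl ⁅ r ⁆ (convex-⁅⁆ r) (λ y∈Y → subst (_∈ ⁅ r ⁆) (sym (Y⊆r y∈Y)) (x∈⁅x⁆ r)))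

  path-inside-convex : ∀ {H s t C} → Convex G C → (P : Path H s t) → C s → C t →
    ∀ i → i ≤ len P → C (vertex P i)
  path-inside-convex {C = C} convC P cs ct i i≤ =
    subst (C ∘ vertex P) (toℕ-clamp i≤) (convC _ _ cs ct (len P) _ (toChordlessPath P) (clamp (len P) i))

  path-inside-cl : ∀ {H s t} X → (P : Path H s t) → X s → X t → ∀ i → i ≤ len P → cl G X (vertex P i)
  path-inside-cl X P xs xt = path-inside-convex (cl-convex X) P (⊆-cl xs) (⊆-cl xt)

  first-step : ∀ {H s t} → Walk H s t → s ≢ t →
    ∃[ v ] H v × Adj G s v × (∀ X → X s → X t → cl G X v)
  first-step {H} {s} {t} w s≢t =
      vertex P 1
    , inside P 1 0<len
    , subst (λ x → Adj G x (vertex P 1)) (start P) (step P 0 0<len)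
    , λ X xs xt → path-inside-cl X P xs xt 1 0<len
    where
    P : Path H s t
    P = fromWalk w
    0<len : 0 < len P
    0<len = n≢0⇒n>0 λ len≡0 → s≢t (trans (sym (start P)) (subst (λ i → vertex P i ≡ t) len≡0 (end P)))

  middle-∈-cl : ∀ {x y z} → x ≢ z → Adj G x y → Adj G y z → ¬ Adj G x z → ∀ X → X x → X z → cl G X y
  middle-∈-cl {x} {y} {z} x≢z xy yz ¬xz X xx xz with first-step x→y→z x≢z
    where
    x→y→z : Walk (λ v → v ≡ x ⊎ v ≡ y ⊎ v ≡ z) x z
    x→y→z = inj₁ refl ∷⟨ xy ⟩ inj₂ (inj₁ refl) ∷⟨ yz ⟩ [ inj₂ (inj₂ refl) ]
  ... | _ , inj₁ refl , xv , _        = ⊥-elim (Adj-irrefl xv)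
  ... | _ , inj₂ (inj₁ refl) , _ , c = c X xx xz
  ... | _ , inj₂ (inj₂ refl) , xv , _ = ⊥-elim (¬xz xv)

module Connectivity {n : ℕ} (G : Graph n) (connected : Connected G) where
  open Adjacency G
  open Paths G
  open Closure G

  connecting-walk : ∀ u v → Walk U u v
  connecting-walk u v with connected u v
  ... | k , p , p₀ , pₖ , p-step =
    subst₂ (Walk U) (trans (cong p (clamp-zero k)) p₀) (trans (cong p (clamp-self k)) pₖ)
           (walk-along (p ∘ clamp k) k (λ i i<k → p-step _ _ (clamp-consecutive i<k)) (λ _ _ → tt))

  convex-walk : ∀ {Y y z} → Convex G Y → Y y → Y z → Walk Y y z
  convex-walk {y = y} {z} convY yy yz = Path⇒Walk P (path-inside-convex convY P yy yz)
    where
    P : Path U y z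
    P = fromWalk (connecting-walk _ _)

  walk-via : ∀ {Y H x y₁ y₂ z t} → Convex G Y → H x → Adj G x y₁ → Y y₁ → Y y₂ → Adj G y₂ z →
    Walk H z t → Walk (Y ∪ₚ H) x t
  walk-via convY hx xy₁ yy₁ yy₂ y₂z rest =
    inj₂ hx ∷⟨ xy₁ ⟩ weaken inj₁ (convex-walk convY yy₁ yy₂) ++ inj₁ yy₂ ∷⟨ y₂z ⟩ weaken inj₂ rest

  cl-meets-convex : ∀ {Y x y y₁ y₂} → Convex G Y → x ≢ y → ¬ Adj G x y →
    Adj G x y₁ → Y y₁ → Adj G y y₂ → Y y₂ → ∀ X → X x → X y → ∃[ c ] cl G X c × Y c
  cl-meets-convex {x = x} {y} convY x≢y ¬xy xy₁ yy₁ yy₂ hy₂ X xx xy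
    with first-step (walk-via {H = λ v → v ≡ x ⊎ v ≡ y} convY (inj₁ refl) xy₁ yy₁ hy₂ (Adj-sym yy₂) [ inj₂ refl ]) x≢y
  ... | v , inj₁ yv , _ , v∈cl          = v , v∈cl X xx xy , yv
  ... | _ , inj₂ (inj₁ refl) , xv , _ = ⊥-elim (Adj-irrefl xv)
  ... | _ , inj₂ (inj₂ refl) , xv , _ = ⊥-elim (¬xy xv)

  B-neighbour⇒A-neighbour : ∀ {A B x b} → Linked G A B → Convex G B → _/_ G B A ⊆ₚ B →
    ¬ A x → ¬ B x → B b → Adj G x b → ¬ ¬ (∃[ a ] A a × Adj G x a)
  B-neighbour⇒A-neighbour {A} {B} {x} (a₀ , b₀ , ha₀ , hb₀ , a₀b₀) convB B/A⊆B ¬ax ¬bx hb xb no-A-neighbour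
    with first-step (walk-via {H = λ v → A v ⊎ v ≡ x} convB (inj₂ refl) xb hb hb₀ (Adj-sym a₀b₀) [ inj₁ ha₀ ])
                    (λ x≡a₀ → ¬ax (subst A (sym x≡a₀) ha₀))
  ... | v , inj₁ bv , _ , v∈cl         = ¬bx (B/A⊆B (v , bv , v∈cl (A ∪ₚ ｛ x ｝) (inj₂ refl) (inj₁ ha₀)))
  ... | v , inj₂ (inj₁ av) , xv , _   = no-A-neighbour (v , av , xv)
  ... | _ , inj₂ (inj₂ refl) , xv , _ = Adj-irrefl xv

module Absorbing {n : ℕ} (G : Graph n) {A B : VSet n} (σ⊆A : σ G A B ⊆ₚ A) where
  open Closure G

  ⊆σ : A ⊆ₚ σ G A B
  ⊆σ {v} a = ⊆-cl (inj₁ (v , a , ⊆-cl (inj₂ refl)))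

  convex : Convex G A
  convex u v au av k p cp i = σ⊆A (cl-convex _ u v (⊆σ au) (⊆σ av) k p cp i)

  stable : ∀ {v} → ¬ ¬ A v → A v
  stable ¬¬a = σ⊆A (cl-stable (¬¬-map ⊆σ ¬¬a))

  /⊆ : _/_ G A B ⊆ₚ A
  /⊆ = σ⊆A ∘ ⊆-cl ∘ inj₁

  MidPart⊆ : MidPart G A B ⊆ₚ A
  MidPart⊆ = σ⊆A ∘ ⊆-cl ∘ inj₂

saturated⇒σ⊆ : ∀ {n} {G : Graph n} {A B : VSet n} → A ≐ S G A B → σ G A B ⊆ₚ A
saturated⇒σ⊆ (_ , S⊆A) σv = S⊆A (0 , σv)

pair-member : ∀ {n} {x p r : Fin n} → x ∈ ⁅ p ⁆ ∪ˢ ⁅ r ⁆ → x ≡ p ⊎ x ≡ r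
pair-member {p = p} {r} x∈ = Sum.map (x∈⁅y⁆⇒x≡y p) (x∈⁅y⁆⇒x≡y r) (x∈p∪q⁻ ⁅ p ⁆ ⁅ r ⁆ x∈)

module Separation {n : ℕ} (G : Graph n) (connected : Connected G) {A B : VSet n}
                  (linked : Linked G A B) (σ⊆A : σ G A B ⊆ₚ A) (σ⊆B : σ G B A ⊆ₚ B) where
  open Adjacency G
  open Paths G
  open Path
  open Closure G
  open Connectivity G connected
  open RawMonad (¬¬-Monad {0ℓ}) using (_>>=_; pure)
  private
    module 𝔸 = Absorbing G σ⊆A
    module 𝔹 = Absorbing G σ⊆B

  N∪ : VSet n
  N∪ = N G (A ∪ₚ B)

  ∉A : ∀ {x} → N∪ x → ¬ A x
  ∉A (∉A∪B , _) = ∉A∪B ∘ inj₁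

  ∉B : ∀ {x} → N∪ x → ¬ B x
  ∉B (∉A∪B , _) = ∉A∪B ∘ inj₂

  has-A-neighbour : ∀ {x} → N∪ x → ¬ ¬ (∃[ a ] A a × Adj G x a)
  has-A-neighbour (_ , y , inj₁ ay , xy) = pure (y , ay , xy)
  has-A-neighbour nx@(_ , _ , inj₂ by , xy) =
    B-neighbour⇒A-neighbour linked 𝔹.convex 𝔹./⊆ (∉A nx) (∉B nx) by xy

  has-B-neighbour : ∀ {x} → N∪ x → ¬ ¬ (∃[ b ] B b × Adj G x b)
  has-B-neighbour (_ , y , inj₂ by , xy) = pure (y , by , xy)
  has-B-neighbour nx@(_ , _ , inj₁ ay , xy) =
    B-neighbour⇒A-neighbour (Linked-sym linked) 𝔸.convex 𝔸./⊆ (∉B nx) (∉A nx) ay xy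

  nonadjacent-share-A-neighbours : ∀ {x z a} → N∪ x → N∪ z → ¬ Adj G x z → A a → Adj G z a → Adj G x a
  nonadjacent-share-A-neighbours {x} {z} {a} nx nz ¬xz ha za = decidable-stable (adj? x a) do
    (_ , hbx , xbx) ← has-B-neighbour nx
    (_ , hbz , zbz) ← has-B-neighbour nz
    pure (second-vertex (first-step (walk-via {H = H} 𝔹.convex (inj₁ refl) xbx hbx hbz (Adj-sym zbz)
                                         (inj₂ (inj₁ refl) ∷⟨ za ⟩ [ inj₂ (inj₂ refl) ]))
                                    (λ x≡a → ∉A nx (subst A (sym x≡a) ha))))
    where
    H : VSet n
    H v = v ≡ x ⊎ v ≡ z ⊎ v ≡ a
    second-vertex : ∃[ v ] (B ∪ₚ H) v × Adj G x v × (∀ X → X x → X a → cl G X v) → Adj G x a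
    second-vertex (v , inj₁ bv , _ , v∈cl) =
      ⊥-elim (∉B nx (𝔹./⊆ (v , bv , v∈cl (A ∪ₚ ｛ x ｝) (inj₂ refl) (inj₁ ha))))
    second-vertex (_ , inj₂ (inj₁ refl) , xv , _)         = ⊥-elim (Adj-irrefl xv)
    second-vertex (_ , inj₂ (inj₂ (inj₁ refl)) , xv , _) = ⊥-elim (¬xz xv)
    second-vertex (_ , inj₂ (inj₂ (inj₂ refl)) , xv , _) = xv

  nonadjacent-in-cl⇒∈B : ∀ {x y u} → N∪ x → N∪ y → x ≢ y → ¬ Adj G x y →
    cl G (A ∪ₚ ｛ u ｝) x → cl G (A ∪ₚ ｛ u ｝) y → B u
  nonadjacent-in-cl⇒∈B nx ny x≢y ¬xy cx cy = 𝔹.stable do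
    (_ , hbx , xbx) ← has-B-neighbour nx
    (_ , hby , yby) ← has-B-neighbour ny
    let (c , c∈cl , bc) = cl-meets-convex 𝔹.convex x≢y ¬xy xbx hbx yby hby _ cx cy
    pure (𝔹./⊆ (c , bc , cl-least id c∈cl))

  nonadjacent-pair-mfs : ∀ {p r} → N∪ p → N∪ r → p ≢ r → ¬ Adj G p r → ¬ ¬ MFS G A B (⁅ p ⁆ ∪ˢ ⁅ r ⁆)
  nonadjacent-pair-mfs {p} {r} np nr p≢r ¬pr = do
    (_ , ha₁ , pa₁) ← has-A-neighbour np
    (_ , ha₂ , ra₂) ← has-A-neighbour nr
    (_ , hb₁ , pb₁) ← has-B-neighbour np
    (_ , hb₂ , rb₂) ← has-B-neighbour nr
    pure ( ( outside
           , cl-meets-convex 𝔸.convex p≢r ¬pr pa₁ ha₁ ra₂ ha₂ ⟦ X ⟧ p∈X r∈X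
           , cl-meets-convex 𝔹.convex p≢r ¬pr pb₁ hb₁ rb₂ hb₂ ⟦ X ⟧ p∈X r∈X )
         , minimal )
    where
    X : Subset n
    X = ⁅ p ⁆ ∪ˢ ⁅ r ⁆
    p∈X : p ∈ X
    p∈X = x∈p∪q⁺ (inj₁ (x∈⁅x⁆ p))
    r∈X : r ∈ X
    r∈X = x∈p∪q⁺ (inj₂ (x∈⁅x⁆ r))
    outside : ∀ x → x ∈ X → ¬ A x × ¬ B x
    outside x x∈X with pair-member x∈X
    ... | inj₁ refl = ∉A np , ∉B np
    ... | inj₂ refl = ∉A nr , ∉B nr
    forced : ∀ {Y q s} → (∀ {y} → y ∈ Y → y ≡ q ⊎ y ≡ s) → ¬ A s → (∃[ a ] cl G ⟦ Y ⟧ a × A a) → q ∈ Y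
    forced {Y} {q} {s} Y⊆qs ¬as (a , a∈clY , ha) = decidable-stable (q ∈? Y) λ q∉Y →
      ¬as (subst A (cl-⊆-｛｝ (only-s q∉Y) a∈clY) ha)
      where
      only-s : q ∉ Y → ⟦ Y ⟧ ⊆ₚ ｛ s ｝
      only-s q∉Y y∈Y = [ (λ y≡q → ⊥-elim (q∉Y (subst (_∈ Y) y≡q y∈Y))) , id ]′ (Y⊆qs y∈Y)
    minimal : ∀ Y → Y ⊆ˢ X → Forbidden G A B Y → X ⊆ˢ Y
    minimal Y Y⊆X (_ , meets-A , _) x∈X with pair-member x∈X
    ... | inj₁ refl = forced (λ y∈Y → pair-member (Y⊆X y∈Y)) (∉A nr) meets-A
    ... | inj₂ refl = forced (λ y∈Y → Sum.swap (pair-member (Y⊆X y∈Y))) (∉A np) meets-A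

  common-neighbour-∈A : ∀ {p r w a} → N∪ p → N∪ r → p ≢ r → ¬ Adj G p r → Adj G p w → Adj G r w →
    A a → Adj G w a → ¬ Adj G p a → ¬ Adj G r a → A w
  common-neighbour-∈A {p} {r} {w} np nr p≢r ¬pr pw rw ha wa ¬pa ¬ra =
    𝔸.stable (¬¬-map (λ mfs → 𝔸.MidPart⊆ (_ , mfs , w∈cl)) (nonadjacent-pair-mfs np nr p≢r ¬pr))
    where
    w∈cl : ∀ x → x ∈ ⁅ p ⁆ ∪ˢ ⁅ r ⁆ → cl G (A ∪ₚ ｛ x ｝) w
    w∈cl x x∈ with pair-member x∈
    ... | inj₁ refl = middle-∈-cl (λ p≡a → ∉A np (subst A (sym p≡a) ha)) pw wa ¬pa _ (inj₂ refl) (inj₁ ha)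
    ... | inj₂ refl = middle-∈-cl (λ r≡a → ∉A nr (subst A (sym r≡a) ha)) rw wa ¬ra _ (inj₂ refl) (inj₁ ha)

  nonadjacent-adjacent-to-A-neighbours : ∀ {p r w a} → N∪ p → N∪ r → p ≢ r → ¬ Adj G p r →
    N∪ w → A a → Adj G w a → Adj G p a
  nonadjacent-adjacent-to-A-neighbours {p} {r} {w} {a} np nr p≢r ¬pr nw ha wa =
    decidable-stable (adj? p a) λ ¬pa →
      let ¬ra = ¬pa ∘ nonadjacent-share-A-neighbours np nr ¬pr ha
          pw  = decidable-stable (adj? p w) λ ¬pw → ¬pa (nonadjacent-share-A-neighbours np nw ¬pw ha wa)
          rw  = decidable-stable (adj? r w) λ ¬rw → ¬ra (nonadjacent-share-A-neighbours nr nw ¬rw ha wa)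
      in ∉A nw (common-neighbour-∈A np nr p≢r ¬pr pw rw ha wa ¬pa ¬ra)

  same-A-neighbours : ¬ Clique G N∪ → ∀ {u w a} → N∪ u → N∪ w → A a → Adj G w a → Adj G u a
  same-A-neighbours ¬clique {u} {a = a} nu nw ha wa = decidable-stable (adj? u a) λ ¬ua →
    ¬Clique⇒nonadjacent-pair ¬clique λ (x , y , nx , ny , x≢y , ¬xy) → contradict ¬ua nx ny x≢y ¬xy
    where
    apart : ∀ {z} → N∪ z → u ≢ z → ¬ Adj G u z → Adj G u a
    apart nz u≢z ¬uz = nonadjacent-adjacent-to-A-neighbours nu nz u≢z ¬uz nw ha wa
    contradict : ¬ Adj G u a → ∀ {x y} → N∪ x → N∪ y → x ≢ y → ¬ Adj G x y → ⊥
    contradict ¬ua {x} {y} nx ny x≢y ¬xy with u ≟ᶠ x | u ≟ᶠ y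
    ... | yes refl | _        = ¬ua (apart ny x≢y ¬xy)
    ... | _        | yes refl = ¬ua (apart nx (x≢y ∘ sym) (¬xy ∘ Adj-sym))
    ... | no u≢x   | no u≢y with adj? u x | adj? u y
    ...   | no ¬ux | _        = ¬ua (apart nx u≢x ¬ux)
    ...   | _      | no ¬uy   = ¬ua (apart ny u≢y ¬uy)
    ...   | yes ux | yes uy   = ∉B nu (nonadjacent-in-cl⇒∈B nx ny x≢y ¬xy (x∈cl ux xa) (x∈cl uy ya))
      where
      u≢a : u ≢ a
      u≢a u≡a = ∉A nu (subst A (sym u≡a) ha)
      xa : Adj G x a
      xa = nonadjacent-adjacent-to-A-neighbours nx ny x≢y ¬xy nw ha wa
      ya : Adj G y a
      ya = nonadjacent-adjacent-to-A-neighbours ny nx (x≢y ∘ sym) (¬xy ∘ Adj-sym) nw ha wa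
      x∈cl : ∀ {x} → Adj G u x → Adj G x a → cl G (A ∪ₚ ｛ u ｝) x
      x∈cl ux xa = middle-∈-cl u≢a ux xa ¬ua _ (inj₂ refl) (inj₁ ha)

  path-from-N∪-to-A : ¬ Clique G N∪ → ∀ {H u t} → N∪ u → (P : Path H u t) → A t →
    ∀ i → i ≤ len P → (A ∪ₚ ｛ u ｝) (vertex P i)
  path-from-N∪-to-A _       _  P _  zero    _      = inj₂ (start P)
  path-from-N∪-to-A ¬clique {u = u} nu P at (suc i) i<len = inj₁ (beyond (len P ∸ suc i) i (m+[n∸m]≡n i<len))
    where
    -- Downward induction: if w = vertex (j + 1) were not in A it would lie in N(A ∪ B),
    -- so u would share w's A-neighbour vertex (j + 2), giving a chord of P.
    beyond : ∀ d j → suc j + d ≡ len P → A (vertex P (suc j))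
    beyond zero j e =
      subst (A ∘ vertex P) (trans (sym e) (+-identityʳ (suc j))) (subst A (sym (end P)) at)
    beyond (suc d) j e = 𝔸.stable λ ¬a →
      no-chord (same-A-neighbours ¬clique nu (w∈N∪ ¬a) next w-next)
      where
      e′ : suc (suc j) + d ≡ len P
      e′ = trans (sym (+-suc (suc j) d)) e
      j+2≤len : suc (suc j) ≤ len P
      j+2≤len = subst (_ ≤_) e′ (m≤m+n _ d)
      next : A (vertex P (suc (suc j)))
      next = beyond d (suc j) e′
      w-next : Adj G (vertex P (suc j)) (vertex P (suc (suc j)))
      w-next = step P (suc j) j+2≤len
      w∈cl : cl G (A ∪ₚ ｛ u ｝) (vertex P (suc j))
      w∈cl = path-inside-cl _ P (inj₂ refl) (inj₁ at) (suc j) (≤-trans (n≤1+n _) j+2≤len)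
      w∈N∪ : ¬ A (vertex P (suc j)) → N∪ (vertex P (suc j))
      w∈N∪ ¬a = [ ¬a , (λ b → ∉B nu (𝔹./⊆ (_ , b , w∈cl))) ]′ , _ , inj₁ next , w-next
      no-chord : ¬ Adj G u (vertex P (suc (suc j)))
      no-chord ua with chordless P 0 (suc (suc j)) z≤n j+2≤len (subst (λ x → Adj G x _) (sym (start P)) ua)
      ... | inj₁ ()
      ... | inj₂ ()

  convex-A∪neighbour : ¬ Clique G N∪ → ∀ {u} → N∪ u → Convex G (A ∪ₚ ｛ u ｝)
  convex-A∪neighbour _ _ s t (inj₁ as) (inj₁ at) k p cp i = inj₁ (𝔸.convex s t as at k p cp i)
  convex-A∪neighbour _ _ _ _ (inj₂ refl) (inj₂ refl) k p cp i = inj₂ (closed-path-constant cp i)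
  convex-A∪neighbour ¬clique {u} nu _ _ (inj₂ refl) (inj₁ at) k p cp i =
    subst (A ∪ₚ ｛ u ｝) (cong p (clamp-toℕ i))
      (path-from-N∪-to-A ¬clique nu (fromChordlessPath cp) at (toℕ i) (toℕ≤pred[n] i))
  convex-A∪neighbour ¬clique {u} nu _ _ (inj₁ as) (inj₂ refl) k p cp i =
    subst (A ∪ₚ ｛ u ｝) (cong p (trans (cong (clamp k) (m∸[m∸n]≡n (toℕ≤pred[n] i))) (clamp-toℕ i)))
      (path-from-N∪-to-A ¬clique nu (reverse (fromChordlessPath cp)) as (k ∸ toℕ i) (m∸n≤m k (toℕ i)))

  convex-A∪clique : ¬ Clique G N∪ → ∀ {K} → Clique G K → K ⊆ₚ N∪ → Convex G (A ∪ₚ K)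
  convex-A∪clique ¬clique {K} clique K⊆N∪ s t s∈ t∈ k p cp i = between s∈ t∈
    where
    widen : ∀ {x v} → K x → (A ∪ₚ ｛ x ｝) v → (A ∪ₚ K) v
    widen _  (inj₁ av)   = inj₁ av
    widen kx (inj₂ refl) = inj₂ kx
    through : ∀ {x} → K x → (A ∪ₚ ｛ x ｝) s → (A ∪ₚ ｛ x ｝) t → (A ∪ₚ K) (p i)
    through kx s∈ t∈ = widen kx (convex-A∪neighbour ¬clique (K⊆N∪ kx) s t s∈ t∈ k p cp i)
    between : (A ∪ₚ K) s → (A ∪ₚ K) t → (A ∪ₚ K) (p i)
    between (inj₁ as) (inj₁ at) = inj₁ (𝔸.convex s t as at k p cp i)
    between (inj₂ ks) (inj₁ at) = through ks (inj₂ refl) (inj₁ at)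
    between (inj₁ as) (inj₂ kt) = through kt (inj₁ as) (inj₂ refl)
    between (inj₂ ks) (inj₂ kt) with s ≟ᶠ t
    ... | yes refl = through ks (inj₂ refl) (inj₂ refl)
    ... | no s≢t   = inj₂ ([ (λ pi≡s → subst K (sym pi≡s) ks) , (λ pi≡t → subst K (sym pi≡t) kt) ]′
                                (adjacent-ends cp (clique s t ks kt s≢t) i))

lemma18 : ∀ {n : ℕ} (G : Graph n) (A B : VSet n)
    → Connected G
    → Linked G A B
    → Disjoint G A B
    → Saturated G A B
    → ¬ Clique G (N G (A ∪ₚ B))
    → ∀ (K : VSet n) → Clique G K → K ⊆ₚ N G (A ∪ₚ B)
    → Convex G (A ∪ₚ K) × Convex G (B ∪ₚ K)
lemma18 G A B connected linked _ (A-saturated , B-saturated) ¬clique _ clique K⊆N =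
    A-side.convex-A∪clique ¬clique clique K⊆N
  , B-side.convex-A∪clique (¬clique ∘ Clique-⊆ N-∪-comm) clique (N-∪-comm ∘ K⊆N)
  where
  open Adjacency G
  σ⊆A : σ G A B ⊆ₚ A
  σ⊆A = saturated⇒σ⊆ A-saturated
  σ⊆B : σ G B A ⊆ₚ B
  σ⊆B = saturated⇒σ⊆ B-saturated
  module A-side = Separation G connected linked σ⊆A σ⊆B
  module B-side = Separation G connected (Linked-sym linked) σ⊆B σ⊆A
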